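{- Let $G$ be a graph, $f:E(G)\to\mathbb{N}$ an injective edge labeling, and $v$ a vertex of degree $3$ whose incident edges are labelled $x$, $x+d$, $x+2d$ for some positive integers $x,d$ (an arithmetic progression with common difference $d$ and least element $x$). If $x\ne d$, then $v$ is an AR-vertex.
   Context: All graphs are finite, simple and undirected; $\mathbb{N}=\{1,2,3,\dots\}$. Given an injective edge labeling $f:E(G)\to\mathbb{N}$, a vertex $v$ is an AR-vertex if, whenever $x_1,\dots,x_k$ are the labels of the $k$ edges incident on $v$, the $2^k$ sums $\sum_{i\in S}x_i$ over all subsets $S\subseteq\{1,\dots,k\}$ are pairwise distinct. -}

module Defs where

open import Data.Nat using (ℕ; zero; suc; _+_; _≤_)
open import Data.Bool using (Bool; true; false; if_then_else_)
open import Data.Fin using (Fin; _<_)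
import Data.Fin as F
open import Data.Vec using (Vec; []; _∷_)
open import Data.Product using (Σ; Σ-syntax; _×_; _,_; proj₁; proj₂; ∃-syntax)
open import Data.Sum using (_⊎_)
open import Function.Definitions using (Injective)
open import Relation.Binary.PropositionalEquality using (_≡_)

record Graph : Set where
  field
    n      : ℕ
    Adj    : Fin n → Fin n → Bool
    sym    : ∀ i j → Adj i j ≡ Adj j i
    irrefl : ∀ i → Adj i i ≡ false

open Graph public

Vertex : Graph → Set
Vertex G = Fin (n G)

-- An edge {i,j} is represented uniquely by the ordered pair (i , j) with i < j.
Edge : Graph → Set
Edge G = Σ[ p ∈ Fin (n G) × Fin (n G) ] (proj₁ p < proj₂ p × Adj G (proj₁ p) (proj₂ p) ≡ true)

Incident : (G : Graph) → Vertex G → Edge G → Set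
Incident G v e = proj₁ (proj₁ e) ≡ v ⊎ proj₂ (proj₁ e) ≡ v

IsIncidentEnum : (G : Graph) → Vertex G → (k : ℕ) → (Fin k → Edge G) → Set
IsIncidentEnum G v k e =
  Injective _≡_ _≡_ e
  × (∀ i → Incident G v (e i))
  × (∀ a → Incident G v a → ∃[ i ] e i ≡ a)

IsInjectiveLabeling : (G : Graph) → (Edge G → ℕ) → Set
IsInjectiveLabeling G f = Injective _≡_ _≡_ f × (∀ a → 1 ≤ f a)

subsetSum : ∀ {k} → (Fin k → ℕ) → Vec Bool k → ℕ
subsetSum {zero} x [] = 0
subsetSum {suc k} x (b ∷ S) = (if b then x F.zero else 0) + subsetSum (λ i → x (F.suc i)) S

ARVertex : (G : Graph) → (Edge G → ℕ) → Vertex G → Set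
ARVertex G f v =
  ∀ k (e : Fin k → Edge G) → IsIncidentEnum G v k e →
  ∀ (S T : Vec Bool k) → subsetSum (λ i → f (e i)) S ≡ subsetSum (λ i → f (e i)) T → S ≡ T

-- Any two enumerations of the edges at v differ by a permutation, and subset sums are
-- invariant under permutations, so it suffices to treat the enumeration with labels
-- x, x + d, x + 2d. A subset of size c whose offsets (0, 1 or 2 per element) add up to s
-- has sum c·x + s·d, and for these offsets |c − s| ≤ 1. If two subsets have equal sums
-- and sizes c < c′, then s > s′, which squeezes c′ ≤ s′ + 1 ≤ s ≤ c + 1 ≤ c′; so the sums
-- are c·x + (c+1)·d and (c+1)·x + c·d, whose equality means x = d.
module Submission where

open import Defs hiding (n; sym)
open import Algebra.Properties.CommutativeMonoid.Sum as Sum using ()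
open import Data.Bool using (Bool; true; false; if_then_else_)
open import Data.Fin using (Fin; toℕ) renaming (zero to fzero; suc to fsuc)
open import Data.Fin.Permutation using (Permutation; permutation; _⟨$⟩ʳ_; _⟨$⟩ˡ_; inverseʳ)
open import Data.Nat using (ℕ; zero; suc; _+_; _*_; _≤_; NonZero; >-nonZero)
open import Data.Nat.Properties
open import Data.Nat.Tactic.RingSolver using (solve-∀)
open import Data.Product using (Σ-syntax; _×_; _,_; proj₁; proj₂; uncurry)
import Data.Product as Product
open import Data.Sum using (inj₁; inj₂)
open import Data.Vec using (Vec; []; _∷_; lookup; tabulate)
open import Data.Vec.Properties using (lookup∘tabulate; tabulate∘lookup; tabulate-cong)
open import Function using (_∘_)
open import Function.Definitions using (Injective)
open import Relation.Binary.PropositionalEquality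
  using (_≡_; _≢_; _≗_; refl; sym; trans; cong; cong₂; module ≡-Reasoning)
open import Relation.Nullary using (yes; no; contradiction)

open Sum +-0-commutativeMonoid using (sum; sum-cong-≗; sum-permute)
open ≡-Reasoning

private
  variable
    k m n : ℕ

subsetSum-cong : {w w′ : Fin k → ℕ} → w ≗ w′ → subsetSum w ≗ subsetSum w′
subsetSum-cong {zero}  w≗w′ []      = refl
subsetSum-cong {suc k} w≗w′ (b ∷ S) =
  cong₂ _+_ (cong (λ t → if b then t else 0) (w≗w′ fzero)) (subsetSum-cong (w≗w′ ∘ fsuc) S)

subsetSum-as-sum : (w : Fin k → ℕ) (S : Vec Bool k) →
                   subsetSum w S ≡ sum (λ i → if lookup S i then w i else 0)
subsetSum-as-sum {zero}  w []      = refl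
subsetSum-as-sum {suc k} w (b ∷ S) = cong (_ +_) (subsetSum-as-sum (w ∘ fsuc) S)

reindex : (Fin m → Fin n) → Vec Bool n → Vec Bool m
reindex σ S = tabulate (lookup S ∘ σ)

subsetSum-permute : (π : Permutation m n) (w : Fin n → ℕ) (S : Vec Bool n) →
                    subsetSum (w ∘ (π ⟨$⟩ʳ_)) (reindex (π ⟨$⟩ʳ_) S) ≡ subsetSum w S
subsetSum-permute {m} {n} π w S = begin
  subsetSum (w ∘ σ) (reindex σ S)                      ≡⟨ subsetSum-as-sum (w ∘ σ) _ ⟩
  sum (λ i → if lookup (reindex σ S) i then w (σ i) else 0)
    ≡⟨ sum-cong-≗ (λ i → cong (λ b → if b then w (σ i) else 0) (lookup∘tabulate _ i)) ⟩
  sum (λ i → if lookup S (σ i) then w (σ i) else 0)    ≡⟨ sum-permute _ π ⟨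
  sum (λ j → if lookup S j then w j else 0)            ≡⟨ subsetSum-as-sum w S ⟨
  subsetSum w S                                        ∎
  where
  σ : Fin m → Fin n
  σ = π ⟨$⟩ʳ_

reindex-injective : (π : Permutation m n) → Injective _≡_ _≡_ (reindex (π ⟨$⟩ʳ_))
reindex-injective π {S} {T} eq = begin
  S                    ≡⟨ tabulate∘lookup S ⟨
  tabulate (lookup S)  ≡⟨ tabulate-cong agree ⟩
  tabulate (lookup T)  ≡⟨ tabulate∘lookup T ⟩
  T                    ∎
  where
  agree-on-image : ∀ i → lookup S (π ⟨$⟩ʳ i) ≡ lookup T (π ⟨$⟩ʳ i)
  agree-on-image i = begin
    lookup S (π ⟨$⟩ʳ i)            ≡⟨ lookup∘tabulate _ i ⟨
    lookup (reindex (π ⟨$⟩ʳ_) S) i ≡⟨ cong (λ U → lookup U i) eq ⟩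
    lookup (reindex (π ⟨$⟩ʳ_) T) i ≡⟨ lookup∘tabulate _ i ⟩
    lookup T (π ⟨$⟩ʳ i)            ∎
  agree : lookup S ≗ lookup T
  agree j = begin
    lookup S j                      ≡⟨ cong (lookup S) (inverseʳ π) ⟨
    lookup S (π ⟨$⟩ʳ (π ⟨$⟩ˡ j))    ≡⟨ agree-on-image (π ⟨$⟩ˡ j) ⟩
    lookup T (π ⟨$⟩ʳ (π ⟨$⟩ˡ j))    ≡⟨ cong (lookup T) (inverseʳ π) ⟩
    lookup T j                      ∎

module _ (G : Graph) (v : Vertex G) where

  incidentEnum-permutation : {e : Fin m → Edge G} {e′ : Fin n → Edge G} →
    IsIncidentEnum G v m e → IsIncidentEnum G v n e′ →
    Σ[ π ∈ Permutation m n ] (∀ i → e′ (π ⟨$⟩ʳ i) ≡ e i)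
  incidentEnum-permutation {m} {n} {e} {e′} (inj , inc , complete) (inj′ , inc′ , complete′) =
    permutation to from to∘from from∘to , e′∘to
    where
    to : Fin m → Fin n
    to i = proj₁ (complete′ (e i) (inc i))
    e′∘to : ∀ i → e′ (to i) ≡ e i
    e′∘to i = proj₂ (complete′ (e i) (inc i))
    from : Fin n → Fin m
    from j = proj₁ (complete (e′ j) (inc′ j))
    e∘from : ∀ j → e (from j) ≡ e′ j
    e∘from j = proj₂ (complete (e′ j) (inc′ j))
    to∘from : ∀ j → to (from j) ≡ j
    to∘from j = inj′ (trans (e′∘to (from j)) (e∘from j))
    from∘to : ∀ i → from (to i) ≡ i
    from∘to i = inj (trans (e∘from (to i)) (e′∘to i))

  ARVertex-fromEnumeration : (f : Edge G → ℕ) {e : Fin m → Edge G} → IsIncidentEnum G v m e →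
    Injective _≡_ _≡_ (subsetSum (f ∘ e)) → ARVertex G f v
  ARVertex-fromEnumeration {m} f {e} enum injective k e′ enum′ S T eq =
    reindex-injective π (injective (begin
      subsetSum (f ∘ e) (reindex σ S)  ≡⟨ via-e S ⟨
      subsetSum (f ∘ e′) S             ≡⟨ eq ⟩
      subsetSum (f ∘ e′) T             ≡⟨ via-e T ⟩
      subsetSum (f ∘ e) (reindex σ T)  ∎))
    where
    matching : Σ[ π ∈ Permutation m k ] (∀ i → e′ (π ⟨$⟩ʳ i) ≡ e i)
    matching = incidentEnum-permutation enum enum′
    π : Permutation m k
    π = proj₁ matching
    σ : Fin m → Fin k
    σ = π ⟨$⟩ʳ_
    via-e : ∀ U → subsetSum (f ∘ e′) U ≡ subsetSum (f ∘ e) (reindex σ U)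
    via-e U = begin
      subsetSum (f ∘ e′) U               ≡⟨ subsetSum-permute π (f ∘ e′) U ⟨
      subsetSum (f ∘ e′ ∘ σ) (reindex σ U)
        ≡⟨ subsetSum-cong (cong f ∘ proj₂ matching) _ ⟩
      subsetSum (f ∘ e) (reindex σ U)    ∎

size : Vec Bool k → ℕ
size = subsetSum (λ _ → 1)

subsetSum-affine : (x d : ℕ) (o : Fin k → ℕ) (S : Vec Bool k) →
                   subsetSum (λ i → x + o i * d) S ≡ size S * x + subsetSum o S * d
subsetSum-affine {zero}  x d o []          = refl
subsetSum-affine {suc k} x d o (false ∷ S) = subsetSum-affine x d (o ∘ fsuc) S
subsetSum-affine {suc k} x d o (true ∷ S)  = begin
  x + o fzero * d + subsetSum (λ i → x + o (fsuc i) * d) S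
    ≡⟨ cong (x + o fzero * d +_) (subsetSum-affine x d (o ∘ fsuc) S) ⟩
  x + o fzero * d + (size S * x + subsetSum (o ∘ fsuc) S * d)
    ≡⟨ regroup x d (o fzero) (size S) (subsetSum (o ∘ fsuc) S) ⟩
  suc (size S) * x + (o fzero + subsetSum (o ∘ fsuc) S) * d ∎
  where
  regroup : ∀ x d a c s → x + a * d + (c * x + s * d) ≡ suc c * x + (a + s) * d
  regroup = solve-∀

offset : Vec Bool k → ℕ
offset = subsetSum toℕ

WithinOne : ℕ → ℕ → Set
WithinOne c s = c ≤ suc s × s ≤ suc c

size-withinOne-offset : (S : Vec Bool 3) → WithinOne (size S) (offset S)
size-withinOne-offset (false ∷ false ∷ false ∷ []) = ≤ᵇ⇒≤ _ _ _ , ≤ᵇ⇒≤ _ _ _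
size-withinOne-offset (false ∷ false ∷ true  ∷ []) = ≤ᵇ⇒≤ _ _ _ , ≤ᵇ⇒≤ _ _ _
size-withinOne-offset (false ∷ true  ∷ false ∷ []) = ≤ᵇ⇒≤ _ _ _ , ≤ᵇ⇒≤ _ _ _
size-withinOne-offset (false ∷ true  ∷ true  ∷ []) = ≤ᵇ⇒≤ _ _ _ , ≤ᵇ⇒≤ _ _ _
size-withinOne-offset (true  ∷ false ∷ false ∷ []) = ≤ᵇ⇒≤ _ _ _ , ≤ᵇ⇒≤ _ _ _
size-withinOne-offset (true  ∷ false ∷ true  ∷ []) = ≤ᵇ⇒≤ _ _ _ , ≤ᵇ⇒≤ _ _ _
size-withinOne-offset (true  ∷ true  ∷ false ∷ []) = ≤ᵇ⇒≤ _ _ _ , ≤ᵇ⇒≤ _ _ _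
size-withinOne-offset (true  ∷ true  ∷ true  ∷ []) = ≤ᵇ⇒≤ _ _ _ , ≤ᵇ⇒≤ _ _ _

fromSizeOffset : ℕ → ℕ → Vec Bool 3
fromSizeOffset 1 0 = true  ∷ false ∷ false ∷ []
fromSizeOffset 1 1 = false ∷ true  ∷ false ∷ []
fromSizeOffset 1 2 = false ∷ false ∷ true  ∷ []
fromSizeOffset 2 1 = true  ∷ true  ∷ false ∷ []
fromSizeOffset 2 2 = true  ∷ false ∷ true  ∷ []
fromSizeOffset 2 3 = false ∷ true  ∷ true  ∷ []
fromSizeOffset 3 3 = true  ∷ true  ∷ true  ∷ []
fromSizeOffset _ _ = false ∷ false ∷ false ∷ []

fromSizeOffset-inverse : (S : Vec Bool 3) → fromSizeOffset (size S) (offset S) ≡ S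
fromSizeOffset-inverse (false ∷ false ∷ false ∷ []) = refl
fromSizeOffset-inverse (false ∷ false ∷ true  ∷ []) = refl
fromSizeOffset-inverse (false ∷ true  ∷ false ∷ []) = refl
fromSizeOffset-inverse (false ∷ true  ∷ true  ∷ []) = refl
fromSizeOffset-inverse (true  ∷ false ∷ false ∷ []) = refl
fromSizeOffset-inverse (true  ∷ false ∷ true  ∷ []) = refl
fromSizeOffset-inverse (true  ∷ true  ∷ false ∷ []) = refl
fromSizeOffset-inverse (true  ∷ true  ∷ true  ∷ []) = refl

size-offset-injective : {S T : Vec Bool 3} → size S ≡ size T → offset S ≡ offset T → S ≡ T
size-offset-injective {S} {T} size≡ offset≡ = begin
  S                                    ≡⟨ fromSizeOffset-inverse S ⟨
  fromSizeOffset (size S) (offset S)   ≡⟨ cong₂ fromSizeOffset size≡ offset≡ ⟩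
  fromSizeOffset (size T) (offset T)   ≡⟨ fromSizeOffset-inverse T ⟩
  T                                    ∎

adjacent-swap⇒≡ : ∀ c {x d} → c * x + suc c * d ≡ suc c * x + c * d → x ≡ d
adjacent-swap⇒≡ c {x} {d} eq = sym (+-cancelˡ-≡ (c * x + c * d) d x (begin
  c * x + c * d + d     ≡⟨ left c x d ⟩
  c * x + suc c * d     ≡⟨ eq ⟩
  suc c * x + c * d     ≡⟨ right c x d ⟩
  c * x + c * d + x     ∎))
  where
  left : ∀ c x d → c * x + c * d + d ≡ c * x + suc c * d
  left = solve-∀
  right : ∀ c x d → suc c * x + c * d ≡ c * x + c * d + x
  right = solve-∀

module _ {x d : ℕ} (x≥1 : 1 ≤ x) (d≥1 : 1 ≤ d) (x≢d : x ≢ d) where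

  private instance
    x-nonZero : NonZero x
    x-nonZero = >-nonZero x≥1
    d-nonZero : NonZero d
    d-nonZero = >-nonZero d≥1

  affine-injective-≤ : ∀ {c s c′ s′} → c ≤ c′ → s ≤ suc c → c′ ≤ suc s′ →
    c * x + s * d ≡ c′ * x + s′ * d → c ≡ c′ × s ≡ s′
  affine-injective-≤ {c} {s} {c′} {s′} c≤c′ s≤1+c c′≤1+s′ eq with m≤n⇒m<n∨m≡n c≤c′
  ... | inj₂ refl = refl , *-cancelʳ-≡ s s′ d (+-cancelˡ-≡ (c * x) (s * d) (s′ * d) eq)
  ... | inj₁ c<c′ with s′ <? s
  ...   | no s′≮s = contradiction eq
          (<⇒≢ (+-mono-<-≤ (*-monoˡ-< x c<c′) (*-monoˡ-≤ d (≮⇒≥ s′≮s))))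
  ...   | yes s′<s = contradiction (adjacent-swap⇒≡ c (begin
          c * x + suc c * d   ≡⟨ cong (λ t → c * x + t * d) s≡1+c ⟨
          c * x + s * d       ≡⟨ eq ⟩
          c′ * x + s′ * d     ≡⟨ cong₂ (λ a b → a * x + b * d) c′≡1+c s′≡c ⟩
          suc c * x + c * d   ∎)) x≢d
    where
    s≡1+c : s ≡ suc c
    s≡1+c = ≤-antisym s≤1+c (≤-trans c<c′ (≤-trans c′≤1+s′ s′<s))
    c′≡1+c : c′ ≡ suc c
    c′≡1+c = ≤-antisym (≤-trans c′≤1+s′ (≤-trans s′<s s≤1+c)) c<c′
    s′≡c : s′ ≡ c
    s′≡c = suc-injective (≤-antisym (≤-trans s′<s s≤1+c) (≤-trans c<c′ c′≤1+s′))

  affine-injective : ∀ {c s c′ s′} → WithinOne c s → WithinOne c′ s′ →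
    c * x + s * d ≡ c′ * x + s′ * d → c ≡ c′ × s ≡ s′
  affine-injective {c} {s} {c′} {s′} (c≤1+s , s≤1+c) (c′≤1+s′ , s′≤1+c′) eq with ≤-total c c′
  ... | inj₁ c≤c′ = affine-injective-≤ c≤c′ s≤1+c c′≤1+s′ eq
  ... | inj₂ c′≤c = Product.map sym sym (affine-injective-≤ c′≤c s′≤1+c′ c≤1+s (sym eq))

  progression-subsetSum-injective : Injective _≡_ _≡_ (subsetSum (λ (i : Fin 3) → x + toℕ i * d))
  progression-subsetSum-injective {S} {T} eq =
    uncurry size-offset-injective (affine-injective
      (size-withinOne-offset S) (size-withinOne-offset T)
      (trans (sym (subsetSum-affine x d toℕ S)) (trans eq (subsetSum-affine x d toℕ T))))

lemma4 : (G : Graph) (f : Edge G → ℕ) → IsInjectiveLabeling G f →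
    (v : Vertex G) (x d : ℕ) → 1 ≤ x → 1 ≤ d →
    (e : Fin 3 → Edge G) → IsIncidentEnum G v 3 e →
    f (e Fin.zero) ≡ x → f (e (Fin.suc Fin.zero)) ≡ x + d →
    f (e (Fin.suc (Fin.suc Fin.zero))) ≡ x + 2 * d →
    x ≢ d → ARVertex G f v
lemma4 G f _ v x d x≥1 d≥1 e enum label₀ label₁ label₂ x≢d =
  ARVertex-fromEnumeration G v f enum λ {S} {T} eq →
    progression-subsetSum-injective x≥1 d≥1 x≢d (begin
      subsetSum progression S  ≡⟨ subsetSum-cong labels S ⟨
      subsetSum (f ∘ e) S      ≡⟨ eq ⟩
      subsetSum (f ∘ e) T      ≡⟨ subsetSum-cong labels T ⟩
      subsetSum progression T  ∎)
  where
  progression : Fin 3 → ℕ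
  progression i = x + toℕ i * d
  labels : f ∘ e ≗ progression
  labels fzero                 = trans label₀ (sym (+-identityʳ x))
  labels (fsuc fzero)          = trans label₁ (cong (x +_) (sym (*-identityˡ d)))
  labels (fsuc (fsuc fzero))   = label₂
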